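{- Let $T$ be a tree with $n\ge1$ vertices, let $t\ge1$ be an integer, and let $s$ be a $t$-dilated configuration on $T$ that is not minimally $t$-dilated on $T$. Then there exists $i\in\{1,\dots,n\}$ such that $s-e_i$ is a $t$-dilated configuration on $T$.
   Context: Label the vertices $v_1,\dots,v_n$; $e_i$ is the $i$th standard basis vector of $\mathbb{Z}^n$. A chip configuration on $T$ is a vector $s\in\mathbb{Z}_{\ge0}^n$ ($s_i$ chips on $v_i$); the number of chips on a subtree is the sum of entries over its vertices. A subtree is a nonempty connected subgraph. For $t\ge1$, $s$ is $t$-dilated on $T$ if it has at least $t(m-1)$ chips on every $m$-vertex subtree of $T$, and minimally $t$-dilated on $T$ if it is $t$-dilated and has exactly $t(n-1)$ chips in total. -}

module Defs where

open import Data.Nat using (ℕ; zero; suc; _+_; _*_; _∸_; _≤_)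
open import Data.Fin using (Fin; zero; suc)
open import Data.Fin.Subset using (Subset; _∈_; ∣_∣; ⊤)
open import Data.Bool using (true; false; if_then_else_)
open import Data.Vec using (lookup)
open import Data.List using (List; []; _∷_; length)
open import Data.List.Relation.Unary.Unique.Propositional using (Unique)
open import Data.Product using (Σ; _×_; ∃)
open import Relation.Nullary using (¬_; does)
open import Relation.Binary.PropositionalEquality using (_≡_)
import Data.Fin as F

record SimpleGraph (n : ℕ) : Set₁ where
  field
    Adj    : Fin n → Fin n → Set
    sym    : ∀ {x y} → Adj x y → Adj y x
    irrefl : ∀ {x} → ¬ Adj x x
open SimpleGraph public

data WalkIn {n : ℕ} (G : SimpleGraph n) (S : Subset n) : Fin n → Fin n → Set where
  stop : ∀ {x} → x ∈ S → WalkIn G S x x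
  step : ∀ {x y z} → x ∈ S → Adj G x y → WalkIn G S y z → WalkIn G S x z

ConnectedOn : {n : ℕ} → SimpleGraph n → Subset n → Set
ConnectedOn G S = ∀ x y → x ∈ S → y ∈ S → WalkIn G S x y

Chain : {n : ℕ} → SimpleGraph n → List (Fin n) → Set
Chain G []            = Data.Unit.⊤ where import Data.Unit
Chain G (x ∷ [])      = Data.Unit.⊤ where import Data.Unit
Chain G (x ∷ y ∷ xs)  = Adj G x y × Chain G (y ∷ xs)

last : {n : ℕ} → Fin n → List (Fin n) → Fin n
last x []       = x
last x (y ∷ ys) = last y ys

-- A cycle: distinct vertices x, x₁, …, x_k (k ≥ 2, so at least 3 vertices),
-- consecutive ones adjacent, and the last adjacent to x.
IsCycle : {n : ℕ} → SimpleGraph n → List (Fin n) → Set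
IsCycle G []       = Data.Empty.⊥ where import Data.Empty
IsCycle G (x ∷ xs) = (2 ≤ length xs) × Unique (x ∷ xs) × Chain G (x ∷ xs) × Adj G (last x xs) x

Acyclic : {n : ℕ} → SimpleGraph n → Set
Acyclic G = ∀ c → ¬ IsCycle G c

IsTree : {n : ℕ} → SimpleGraph n → Set
IsTree {n} G = ConnectedOn G ⊤ × Acyclic G

IsSubtree : {n : ℕ} → SimpleGraph n → Subset n → Set
IsSubtree G S = (∃ λ x → x ∈ S) × ConnectedOn G S

Config : ℕ → Set
Config n = Fin n → ℕ

sumFin : {n : ℕ} → (Fin n → ℕ) → ℕ
sumFin {zero}  f = 0
sumFin {suc n} f = f zero + sumFin (λ i → f (suc i))

chipsOn : {n : ℕ} → Config n → Subset n → ℕ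
chipsOn s S = sumFin (λ i → if lookup S i then s i else 0)

total : {n : ℕ} → Config n → ℕ
total s = sumFin s

Dilated : {n : ℕ} → SimpleGraph n → ℕ → Config n → Set
Dilated G t s = ∀ S → IsSubtree G S → t * (∣ S ∣ ∸ 1) ≤ chipsOn s S

MinimallyDilated : {n : ℕ} → SimpleGraph n → ℕ → Config n → Set
MinimallyDilated {n} G t s = Dilated G t s × total s ≡ t * (n ∸ 1)

-- s - e_i (only a configuration when s i ≥ 1)
minusE : {n : ℕ} → Config n → Fin n → Config n
minusE s i j = if does (j F.≟ i) then s j ∸ 1 else s j

{-# OPTIONS --safe #-}
-- Call a subtree S tight if it carries exactly t(|S|-1) chips. If no chip can be removed,
-- every vertex u lies in a tight subtree: {u} when u has no chip, and otherwise a subtree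
-- violated by s - e_u, which must contain u and was short of only that chip. In a tree the
-- union and intersection of overlapping subtrees are subtrees, so modularity of chip counts
-- makes the union of overlapping tight subtrees tight, while two disjoint adjacent tight
-- subtrees would leave their union t chips short. A tight subtree thus grows along edges
-- until it is the whole tree, whence s carries exactly t(n-1) chips.
module Submission where

open import Defs renaming (sym to Adj-sym)
open import Data.Nat using (ℕ; zero; suc; _+_; _*_; _∸_; _≤_; _<_; s≤s; z≤n; _≤?_; _<?_)
open import Data.Nat.Properties
open import Algebra.Properties.CommutativeSemigroup +-commutativeSemigroup using (interchange)
open import Data.Bool using (Bool; true; false; if_then_else_; _∨_; _∧_)
open import Data.Fin using (Fin; zero; suc; fromℕ<) renaming (_≟_ to _≟ᶠ_)
open import Data.Fin.Properties using (any?; all?)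
open import Data.Fin.Subset
  using (Subset; _∈_; _∉_; _⊆_; _⊂_; _⊃_; ∣_∣; ⊤; ⊥; ∁; _∪_; _∩_; _─_; _-_; ⁅_⁆; Nonempty; Empty; inside)
open import Data.Fin.Subset.Properties
open import Data.Fin.Subset.Induction using (⊂-wellFounded; ⊃-wellFounded)
open import Induction.WellFounded using (Acc; acc)
open import Data.Vec using (_∷_; []; here; there)
open import Data.List using (List; []; _∷_)
open import Data.List.Relation.Unary.All using (All; []; _∷_)
import Data.List.Relation.Unary.All as All
open import Data.List.Relation.Unary.Unique.Propositional using (Unique; []; _∷_)
open import Data.Product using (Σ; _×_; ∃; ∃₂; _,_; proj₁; proj₂)
open import Data.Sum using (_⊎_; inj₁; inj₂)
open import Data.Empty using (⊥-elim)
open import Data.Unit using (tt)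
open import Function using (_∘_)
open import Relation.Nullary using (¬_; Dec; yes; no; contradiction)
open import Relation.Nullary.Decidable using (_×-dec_; _→-dec_; map′; decidable-stable)
open import Relation.Binary using (Decidable)
open import Relation.Binary.PropositionalEquality using (_≡_; _≢_; refl; sym; trans; cong; cong₂; subst; module ≡-Reasoning)

private
  variable
    n : ℕ
    S S′ S₁ S₂ R : Subset n
    u v x y z : Fin n

x∈p─q⇒x∉q : {p q : Subset n} → x ∈ p ─ q → x ∉ q
x∈p─q⇒x∉q {p = _ ∷ _} {inside ∷ _} () here
x∈p─q⇒x∉q {p = _ ∷ _} {_ ∷ _} (there x∈) (there x∈q) = x∈p─q⇒x∉q x∈ x∈q

x∈p-y⇒x≢y : {p : Subset n} → x ∈ p - y → x ≢ y
x∈p-y⇒x≢y {y = y} x∈ refl = x∈p─q⇒x∉q x∈ (x∈⁅x⁆ y)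

x∈p-y⇒x∈p : {p : Subset n} → x ∈ p - y → x ∈ p
x∈p-y⇒x∈p = p─q⊆p _ _

p⊆q⇒p∩r⊆q∩r : {p q r : Subset n} → p ⊆ q → p ∩ r ⊆ q ∩ r
p⊆q⇒p∩r⊆q∩r {p = p} {r = r} p⊆q x∈p∩r with x∈p∩q⁻ p r x∈p∩r
... | x∈p , x∈r = x∈p∩q⁺ (p⊆q x∈p , x∈r)

x∉p⇒p⊆⊤-x : x ∉ S → S ⊆ ⊤ - x
x∉p⇒p⊆⊤-x x∉ y∈ = x∈p∧x≢y⇒x∈p-y ∈⊤ λ { refl → x∉ y∈ }

x∈p⇒0<∣p∣ : x ∈ S → 0 < ∣ S ∣
x∈p⇒0<∣p∣ x∈ = ≤-<-trans z≤n (x∈p⇒∣p-x∣<∣p∣ x∈)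

if-∨-+-if-∧ : ∀ a b (m : ℕ) →
  (if a ∨ b then m else 0) + (if a ∧ b then m else 0) ≡ (if a then m else 0) + (if b then m else 0)
if-∨-+-if-∧ true  true  m = refl
if-∨-+-if-∧ true  false m = refl
if-∨-+-if-∧ false true  m = +-identityʳ m
if-∨-+-if-∧ false false m = refl

chipsOn-∪-∩ : (s : Config n) (p q : Subset n) →
  chipsOn s (p ∪ q) + chipsOn s (p ∩ q) ≡ chipsOn s p + chipsOn s q
chipsOn-∪-∩ s []      []      = refl
chipsOn-∪-∩ s (a ∷ p) (b ∷ q) = begin
  (chip (a ∨ b) + U) + (chip (a ∧ b) + I) ≡⟨ interchange (chip (a ∨ b)) U (chip (a ∧ b)) I ⟩
  (chip (a ∨ b) + chip (a ∧ b)) + (U + I) ≡⟨ cong₂ _+_ (if-∨-+-if-∧ a b (s zero)) (chipsOn-∪-∩ (s ∘ suc) p q) ⟩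
  (chip a + chip b) + (P + Q)             ≡⟨ interchange (chip a) (chip b) P Q ⟩
  (chip a + P) + (chip b + Q)             ∎
  where
  open ≡-Reasoning
  chip : Bool → ℕ
  chip c = if c then s zero else 0
  U I P Q : ℕ
  U = chipsOn (s ∘ suc) (p ∪ q)
  I = chipsOn (s ∘ suc) (p ∩ q)
  P = chipsOn (s ∘ suc) p
  Q = chipsOn (s ∘ suc) q

∣p∣≡chipsOn1 : (p : Subset n) → ∣ p ∣ ≡ chipsOn (λ _ → 1) p
∣p∣≡chipsOn1 []            = refl
∣p∣≡chipsOn1 (true  ∷ p)  = cong suc (∣p∣≡chipsOn1 p)
∣p∣≡chipsOn1 (false ∷ p)  = ∣p∣≡chipsOn1 p

∣p∪q∣+∣p∩q∣≡∣p∣+∣q∣ : (p q : Subset n) → ∣ p ∪ q ∣ + ∣ p ∩ q ∣ ≡ ∣ p ∣ + ∣ q ∣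
∣p∪q∣+∣p∩q∣≡∣p∣+∣q∣ p q = begin
  ∣ p ∪ q ∣ + ∣ p ∩ q ∣                          ≡⟨ cong₂ _+_ (∣p∣≡chipsOn1 (p ∪ q)) (∣p∣≡chipsOn1 (p ∩ q)) ⟩
  chipsOn _ (p ∪ q) + chipsOn _ (p ∩ q)          ≡⟨ chipsOn-∪-∩ (λ _ → 1) p q ⟩
  chipsOn _ p + chipsOn _ q                      ≡⟨ sym (cong₂ _+_ (∣p∣≡chipsOn1 p) (∣p∣≡chipsOn1 q)) ⟩
  ∣ p ∣ + ∣ q ∣                                  ∎
  where open ≡-Reasoning

chipsOn-⊥ : (s : Config n) → chipsOn s ⊥ ≡ 0
chipsOn-⊥ {zero}  s = refl
chipsOn-⊥ {suc n} s = chipsOn-⊥ (s ∘ suc)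

chipsOn-⊤ : (s : Config n) → chipsOn s ⊤ ≡ total s
chipsOn-⊤ {zero}  s = refl
chipsOn-⊤ {suc n} s = cong (s zero +_) (chipsOn-⊤ (s ∘ suc))

chipsOn-⁅⁆ : (s : Config n) (i : Fin n) → chipsOn s ⁅ i ⁆ ≡ s i
chipsOn-⁅⁆ s zero    = trans (cong (s zero +_) (chipsOn-⊥ (s ∘ suc))) (+-identityʳ (s zero))
chipsOn-⁅⁆ s (suc i) = chipsOn-⁅⁆ (s ∘ suc) i

chipsOn-minusE-∉ : (s : Config n) {i : Fin n} → i ∉ S → chipsOn (minusE s i) S ≡ chipsOn s S
chipsOn-minusE-∉ {S = true  ∷ S} s {zero}  i∉ = contradiction here i∉
chipsOn-minusE-∉ {S = false ∷ S} s {zero}  i∉ = refl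
chipsOn-minusE-∉ {S = b ∷ S}     s {suc i} i∉ =
  cong ((if b then s zero else 0) +_) (chipsOn-minusE-∉ (s ∘ suc) (i∉ ∘ there))

chipsOn≤1+chipsOn-minusE : (s : Config n) (i : Fin n) (S : Subset n) →
  chipsOn s S ≤ suc (chipsOn (minusE s i) S)
chipsOn≤1+chipsOn-minusE s zero    (true  ∷ S) = +-monoˡ-≤ _ (m≤n+m∸n (s zero) 1)
chipsOn≤1+chipsOn-minusE s zero    (false ∷ S) = n≤1+n _
chipsOn≤1+chipsOn-minusE s (suc i) (b ∷ S)     =
  ≤-trans (+-monoʳ-≤ (if b then s zero else 0) (chipsOn≤1+chipsOn-minusE (s ∘ suc) i S)) (≤-reflexive (+-suc _ _))

module _ (G : SimpleGraph n) where

  walk-source : WalkIn G S x y → x ∈ S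
  walk-source (stop x∈) = x∈
  walk-source (step x∈ _ _) = x∈

  walk-target : WalkIn G S x y → y ∈ S
  walk-target (stop y∈) = y∈
  walk-target (step _ _ w) = walk-target w

  walk-⊆ : S ⊆ S′ → WalkIn G S x y → WalkIn G S′ x y
  walk-⊆ S⊆S′ (stop x∈) = stop (S⊆S′ x∈)
  walk-⊆ S⊆S′ (step x∈ x~y w) = step (S⊆S′ x∈) x~y (walk-⊆ S⊆S′ w)

  walk-++ : WalkIn G S x y → WalkIn G S y z → WalkIn G S x z
  walk-++ (stop _) w′ = w′
  walk-++ (step x∈ x~y w) w′ = step x∈ x~y (walk-++ w w′)

  walk-reverse : WalkIn G S x y → WalkIn G S y x
  walk-reverse (stop x∈) = stop x∈
  walk-reverse (step x∈ x~y w) = walk-++ (walk-reverse w) (step (walk-source w) (Adj-sym G x~y) (stop x∈))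

  last-departure : x ≢ y → WalkIn G S x y → ∃ λ z → Adj G x z × WalkIn G (S - x) z y
  last-departure {x = x} {y = y} {S = S} x≢y x⇝y with avoids-or-departs x⇝y
    where
    avoids-or-departs : WalkIn G S u y → WalkIn G (S - x) u y ⊎ ∃ λ z → Adj G x z × WalkIn G (S - x) z y
    avoids-or-departs (stop y∈) = inj₁ (stop (x∈p∧x≢y⇒x∈p-y y∈ (x≢y ∘ sym)))
    avoids-or-departs (step {x = u} u∈ u~v v⇝y) with avoids-or-departs v⇝y
    ... | inj₂ departure = inj₂ departure
    ... | inj₁ v⇝y′ with u ≟ᶠ x
    ...   | yes refl = inj₂ (_ , u~v , v⇝y′)
    ...   | no u≢x = inj₁ (step (x∈p∧x≢y⇒x∈p-y u∈ u≢x) u~v v⇝y′)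
  ... | inj₁ x⇝y′ = contradiction refl (x∈p-y⇒x≢y (walk-source x⇝y′))
  ... | inj₂ departure = departure

  -- Each step deletes the vertex it leaves from the allowed set, so a path never revisits a vertex.
  data Path : Subset n → Fin n → Fin n → Set where
    end : x ∈ S → Path S x x
    via : x ∈ S → Adj G x z → Path (S - x) z y → Path S x y

  path-source : Path S x y → x ∈ S
  path-source (end x∈) = x∈
  path-source (via x∈ _ _) = x∈

  path⇒walk : Path S x y → WalkIn G S x y
  path⇒walk (end x∈) = stop x∈
  path⇒walk (via x∈ x~z p) = step x∈ x~z (walk-⊆ x∈p-y⇒x∈p (path⇒walk p))

  walk⇒path : WalkIn G S x y → Path S x y
  walk⇒path = go (⊂-wellFounded _)
    where
    go : Acc _⊂_ S → WalkIn G S x y → Path S x y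
    go {x = x} {y = y} (acc smaller) x⇝y with x ≟ᶠ y
    ... | yes refl = end (walk-source x⇝y)
    ... | no x≢y with last-departure x≢y x⇝y | walk-source x⇝y
    ...   | _ , x~z , z⇝y | x∈ = via x∈ x~z (go (smaller (x∈p⇒p-x⊂p x∈)) z⇝y)

  successors : Path S x y → List (Fin n)
  successors (end _) = []
  successors (via {z = z} _ _ p) = z ∷ successors p

  path-⊆ : (p : Path S x y) → All (_∈ S) (x ∷ successors p)
  path-⊆ (end x∈) = x∈ ∷ []
  path-⊆ (via x∈ _ p) = x∈ ∷ All.map x∈p-y⇒x∈p (path-⊆ p)

  path-unique : (p : Path S x y) → Unique (x ∷ successors p)
  path-unique (end _) = [] ∷ []
  path-unique (via _ _ p) = All.map (λ z∈ → x∈p-y⇒x≢y z∈ ∘ sym) (path-⊆ p) ∷ path-unique p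

  path-chain : (p : Path S x y) → Chain G (x ∷ successors p)
  path-chain (end _) = tt
  path-chain (via _ x~z p) = x~z , path-chain p

  path-last : (p : Path S x y) → last x (successors p) ≡ y
  path-last (end _) = refl
  path-last (via _ _ p) = path-last p

  neighbours-separated : Acyclic G → Adj G z u → WalkIn G (S - z) u v → Adj G v z → u ≡ v
  neighbours-separated {z = z} {u = u} acyclic z~u u⇝v v~z with walk⇒path u⇝v
  ... | end _ = refl
  ... | p@(via _ _ _) = ⊥-elim (acyclic (z ∷ u ∷ successors p)
          ( s≤s (s≤s z≤n)
          , All.map (λ v∈ → x∈p-y⇒x≢y v∈ ∘ sym) (path-⊆ p) ∷ path-unique p
          , (z~u , path-chain p)
          , subst (λ y → Adj G y z) (sym (path-last p)) v~z ))

  Adj? : IsTree G → Decidable (Adj G)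
  Adj? (connected , acyclic) x y with x ≟ᶠ y
  ... | yes refl = no (irrefl G)
  ... | no x≢y with last-departure x≢y (connected x y ∈⊤ ∈⊤)
  ...   | z , x~z , z⇝y with z ≟ᶠ y
  ...     | yes refl = yes x~z
  ...     | no z≢y = no λ x~y → z≢y (neighbours-separated acyclic x~z z⇝y (Adj-sym G x~y))

  path-∩-walk : Acyclic G → Path S₁ x y → WalkIn G S₂ x y → WalkIn G (S₁ ∩ S₂) x y
  path-∩-walk acyclic (end x∈) x⇝y = stop (x∈p∩q⁺ (x∈ , walk-source x⇝y))
  path-∩-walk {x = x} {S₂ = S₂} acyclic (via {z = z} x∈ x~z z⇝y) x⇝y with z ∈? S₂
  ... | yes z∈ = step (x∈p∩q⁺ (x∈ , walk-source x⇝y)) x~z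
                   (walk-⊆ (p⊆q⇒p∩r⊆q∩r x∈p-y⇒x∈p) (path-∩-walk acyclic z⇝y (step z∈ (Adj-sym G x~z) x⇝y)))
  ... | no z∉ with last-departure z≢y (path⇒walk z⇝y)
    where
    z≢y : z ≢ _
    z≢y refl = z∉ (walk-target x⇝y)
  ...   | u , z~u , u⇝y = contradiction u≡x (x∈p-y⇒x≢y (x∈p-y⇒x∈p (walk-source u⇝y)))
    where
    -- The path leaves S₂ at z; its continuation and the walk back inside S₂
    -- join two neighbours of z without passing through z.
    u⇝x : WalkIn G (⊤ - z) u x
    u⇝x = walk-++ (walk-⊆ (x∉p⇒p⊆⊤-x λ z∈ → x∈p-y⇒x≢y z∈ refl) u⇝y) (walk-⊆ (x∉p⇒p⊆⊤-x z∉) (walk-reverse x⇝y))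
    u≡x : u ≡ x
    u≡x = neighbours-separated acyclic z~u u⇝x x~z

  subtree-∩ : Acyclic G → IsSubtree G S₁ → IsSubtree G S₂ → Nonempty (S₁ ∩ S₂) → IsSubtree G (S₁ ∩ S₂)
  subtree-∩ {S₁ = S₁} {S₂ = S₂} acyclic (_ , c₁) (_ , c₂) meet = meet , connected
    where
    connected : ConnectedOn G (S₁ ∩ S₂)
    connected x y x∈ y∈ with x∈p∩q⁻ S₁ S₂ x∈ | x∈p∩q⁻ S₁ S₂ y∈
    ... | x∈₁ , x∈₂ | y∈₁ , y∈₂ = path-∩-walk acyclic (walk⇒path (c₁ x y x∈₁ y∈₁)) (c₂ x y x∈₂ y∈₂)

  subtree-∪ : IsSubtree G S₁ → IsSubtree G S₂ → u ∈ S₁ → v ∈ S₂ → WalkIn G (S₁ ∪ S₂) u v →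
              IsSubtree G (S₁ ∪ S₂)
  subtree-∪ {S₁ = S₁} {S₂ = S₂} {u = u} {v = v} (_ , c₁) (_ , c₂) u∈ v∈ u⇝v =
    (u , x∈p∪q⁺ (inj₁ u∈)) , λ x y x∈ y∈ → join (x∈p∪q⁻ S₁ S₂ x∈) (x∈p∪q⁻ S₁ S₂ y∈)
    where
    in₁ : ∀ {a b} → WalkIn G S₁ a b → WalkIn G (S₁ ∪ S₂) a b
    in₁ = walk-⊆ (p⊆p∪q S₂)
    in₂ : ∀ {a b} → WalkIn G S₂ a b → WalkIn G (S₁ ∪ S₂) a b
    in₂ = walk-⊆ (q⊆p∪q S₁ S₂)
    join : x ∈ S₁ ⊎ x ∈ S₂ → y ∈ S₁ ⊎ y ∈ S₂ → WalkIn G (S₁ ∪ S₂) x y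
    join (inj₁ x∈₁) (inj₁ y∈₁) = in₁ (c₁ _ _ x∈₁ y∈₁)
    join (inj₂ x∈₂) (inj₂ y∈₂) = in₂ (c₂ _ _ x∈₂ y∈₂)
    join (inj₁ x∈₁) (inj₂ y∈₂) = walk-++ (in₁ (c₁ _ u x∈₁ u∈)) (walk-++ u⇝v (in₂ (c₂ v _ v∈ y∈₂)))
    join (inj₂ x∈₂) (inj₁ y∈₁) = walk-++ (in₂ (c₂ _ v x∈₂ v∈)) (walk-++ (walk-reverse u⇝v) (in₁ (c₁ u _ u∈ y∈₁)))

  overlapping-subtree-∪ : IsSubtree G S₁ → IsSubtree G S₂ → Nonempty (S₁ ∩ S₂) → IsSubtree G (S₁ ∪ S₂)
  overlapping-subtree-∪ {S₁ = S₁} {S₂ = S₂} S₁-subtree S₂-subtree (_ , x∈) with x∈p∩q⁻ S₁ S₂ x∈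
  ... | x∈₁ , x∈₂ = subtree-∪ S₁-subtree S₂-subtree x∈₁ x∈₂ (stop (x∈p∪q⁺ (inj₁ x∈₁)))

  connected-⁅⁆ : ConnectedOn G ⁅ x ⁆
  connected-⁅⁆ {x = x} u v u∈ v∈ with x∈⁅y⁆⇒x≡y x u∈ | x∈⁅y⁆⇒x≡y x v∈
  ... | refl | refl = stop u∈

  exit-edge : x ∈ S → v ∉ S → WalkIn G S′ x v → ∃₂ λ a b → a ∈ S × b ∉ S × Adj G a b
  exit-edge x∈ v∉ (stop _) = contradiction x∈ v∉
  exit-edge {S = S} x∈ v∉ (step {y = y} _ x~y y⇝v) with y ∈? S
  ... | yes y∈ = exit-edge y∈ v∉ y⇝v
  ... | no y∉ = _ , _ , x∈ , y∉ , x~y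

  module _ (Adj? : Decidable (Adj G)) where

    path? : ∀ S x y → Dec (Path S x y)
    path? S = go (⊂-wellFounded S)
      where
      go : ∀ {S} → Acc _⊂_ S → ∀ x y → Dec (Path S x y)
      go {S = S} (acc smaller) x y with x ∈? S
      ... | no x∉ = no (x∉ ∘ path-source)
      ... | yes x∈ with x ≟ᶠ y
      ...   | yes refl = yes (end x∈)
      ...   | no x≢y = map′ (λ (_ , x~z , z⇝y) → via x∈ x~z z⇝y)
                            (λ { (end _) → contradiction refl x≢y ; (via _ x~z z⇝y) → _ , x~z , z⇝y })
                            (any? λ z → Adj? x z ×-dec go (smaller (x∈p⇒p-x⊂p x∈)) z y)

    subtree? : ∀ S → Dec (IsSubtree G S)
    subtree? S = nonempty? S ×-dec connected?
      where
      connected? : Dec (ConnectedOn G S)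
      connected? = all? λ x → all? λ y → x ∈? S →-dec (y ∈? S →-dec map′ path⇒walk walk⇒path (path? S x y))

dilated-or-violated : {G : SimpleGraph n} → (∀ S → Dec (IsSubtree G S)) → ∀ t s →
  Dilated G t s ⊎ ∃ λ S → IsSubtree G S × chipsOn s S < t * (∣ S ∣ ∸ 1)
dilated-or-violated subtree? t s with anySubset? (λ S → subtree? S ×-dec chipsOn s S <? t * (∣ S ∣ ∸ 1))
... | yes violation = inj₂ violation
... | no none = inj₁ λ S S-subtree → ≮⇒≥ λ violated → none (S , S-subtree , violated)

m*[n∸1]+m≡m*n : ∀ m {n} → 0 < n → m * (n ∸ 1) + m ≡ m * n
m*[n∸1]+m≡m*n m {suc n} _ = trans (+-comm (m * n) m) (sym (*-suc m n))

m≤n⇒o≤p⇒m+o≡n+p⇒m≡n : ∀ {m n o p} → m ≤ n → o ≤ p → m + o ≡ n + p → m ≡ n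
m≤n⇒o≤p⇒m+o≡n+p⇒m≡n {m} {n} {o} {p} m≤n o≤p eq = ≤-antisym m≤n (+-cancelʳ-≤ p n m (begin
  n + p ≡⟨ sym eq ⟩
  m + o ≤⟨ +-monoʳ-≤ m o≤p ⟩
  m + p ∎))
  where open ≤-Reasoning

module _ {T : SimpleGraph n} (tree : IsTree T) {t : ℕ} (t≥1 : 1 ≤ t) {s : Config n} (dil : Dilated T t s) where

  private
    violation? : ∀ s′ → Dilated T t s′ ⊎ ∃ λ S → IsSubtree T S × chipsOn s′ S < t * (∣ S ∣ ∸ 1)
    violation? = dilated-or-violated (subtree? T (Adj? T tree)) t

  Tight : Subset n → Set
  Tight S = chipsOn s S ≡ t * (∣ S ∣ ∸ 1)

  Removable : Fin n → Set
  Removable i = 1 ≤ s i × Dilated T t (minusE s i)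

  removable? : ∀ i → Dec (Removable i)
  removable? i with 1 ≤? s i | violation? (minusE s i)
  ... | no s≱1  | _ = no (s≱1 ∘ proj₁)
  ... | yes s≥1 | inj₁ dil′ = yes (s≥1 , dil′)
  ... | yes _   | inj₂ (S , S-subtree , violated) = no λ (_ , dil′) → <⇒≱ violated (dil′ S S-subtree)

  tight-cover : ∀ u → ¬ Removable u → ∃ λ R → IsSubtree T R × u ∈ R × Tight R
  tight-cover u ¬removable with 1 ≤? s u
  ... | no s≱1 = ⁅ u ⁆ , ((u , x∈⁅x⁆ u) , connected-⁅⁆ T) , x∈⁅x⁆ u , ⁅u⁆-tight
    where
    open ≡-Reasoning
    ⁅u⁆-tight : Tight ⁅ u ⁆
    ⁅u⁆-tight = begin
      chipsOn s ⁅ u ⁆      ≡⟨ chipsOn-⁅⁆ s u ⟩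
      s u                  ≡⟨ n<1⇒n≡0 (≰⇒> s≱1) ⟩
      0                    ≡⟨ sym (*-zeroʳ t) ⟩
      t * (1 ∸ 1)          ≡⟨ cong (λ m → t * (m ∸ 1)) (sym (∣⁅x⁆∣≡1 u)) ⟩
      t * (∣ ⁅ u ⁆ ∣ ∸ 1)  ∎
  ... | yes s≥1 with violation? (minusE s u)
  ...   | inj₁ dil′ = contradiction (s≥1 , dil′) ¬removable
  ...   | inj₂ (S , S-subtree , violated) =
          S , S-subtree , u∈S , ≤-antisym (≤-trans (chipsOn≤1+chipsOn-minusE s u S) violated) (dil S S-subtree)
    where
    u∈S : u ∈ S
    u∈S = decidable-stable (u ∈? S) λ u∉S →
      <⇒≱ violated (subst (t * (∣ S ∣ ∸ 1) ≤_) (sym (chipsOn-minusE-∉ s u∉S)) (dil S S-subtree))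

  -- The ⁺ forms state the bound as t|S| versus chips + t, avoiding the truncated t(|S|-1).
  tight⁺ : x ∈ S → Tight S → chipsOn s S + t ≡ t * ∣ S ∣
  tight⁺ x∈ S-tight = trans (cong (_+ t) S-tight) (m*[n∸1]+m≡m*n t (x∈p⇒0<∣p∣ x∈))

  tight⁻ : x ∈ S → chipsOn s S + t ≡ t * ∣ S ∣ → Tight S
  tight⁻ x∈ eq = +-cancelʳ-≡ t _ _ (trans eq (sym (m*[n∸1]+m≡m*n t (x∈p⇒0<∣p∣ x∈))))

  dilated⁺ : IsSubtree T S → t * ∣ S ∣ ≤ chipsOn s S + t
  dilated⁺ {S = S} S-subtree@((_ , x∈) , _) =
    subst (_≤ chipsOn s S + t) (m*[n∸1]+m≡m*n t (x∈p⇒0<∣p∣ x∈)) (+-monoˡ-≤ t (dil S S-subtree))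

  tight-∪-∩ : u ∈ R → v ∈ S → Tight R → Tight S →
    (chipsOn s (R ∪ S) + t) + (chipsOn s (R ∩ S) + t) ≡ t * ∣ R ∪ S ∣ + t * ∣ R ∩ S ∣
  tight-∪-∩ {R = R} {S = S} u∈ v∈ R-tight S-tight = begin
    (chipsOn s (R ∪ S) + t) + (chipsOn s (R ∩ S) + t) ≡⟨ interchange (chipsOn s (R ∪ S)) t (chipsOn s (R ∩ S)) t ⟩
    (chipsOn s (R ∪ S) + chipsOn s (R ∩ S)) + (t + t) ≡⟨ cong (_+ (t + t)) (chipsOn-∪-∩ s R S) ⟩
    (chipsOn s R + chipsOn s S) + (t + t)             ≡⟨ interchange (chipsOn s R) (chipsOn s S) t t ⟩
    (chipsOn s R + t) + (chipsOn s S + t)             ≡⟨ cong₂ _+_ (tight⁺ u∈ R-tight) (tight⁺ v∈ S-tight) ⟩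
    t * ∣ R ∣ + t * ∣ S ∣                             ≡⟨ sym (*-distribˡ-+ t ∣ R ∣ ∣ S ∣) ⟩
    t * (∣ R ∣ + ∣ S ∣)                               ≡⟨ cong (t *_) (sym (∣p∪q∣+∣p∩q∣≡∣p∣+∣q∣ R S)) ⟩
    t * (∣ R ∪ S ∣ + ∣ R ∩ S ∣)                       ≡⟨ *-distribˡ-+ t ∣ R ∪ S ∣ ∣ R ∩ S ∣ ⟩
    t * ∣ R ∪ S ∣ + t * ∣ R ∩ S ∣                     ∎
    where open ≡-Reasoning

  tight-∪ : IsSubtree T R → IsSubtree T S → Nonempty (R ∩ S) → Tight R → Tight S → Tight (R ∪ S)
  tight-∪ {R = R} {S = S} R-subtree S-subtree meet@(_ , x∈R∩S) R-tight S-tight with x∈p∩q⁻ R S x∈R∩S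
  ... | x∈R , x∈S = tight⁻ (x∈p∪q⁺ (inj₁ x∈R)) (sym (m≤n⇒o≤p⇒m+o≡n+p⇒m≡n
          (dilated⁺ (overlapping-subtree-∪ T R-subtree S-subtree meet))
          (dilated⁺ (subtree-∩ T (proj₂ tree) R-subtree S-subtree meet))
          (sym (tight-∪-∩ x∈R x∈S R-tight S-tight))))

  tight-apart : IsSubtree T R → IsSubtree T S → Tight R → Tight S →
                Empty (R ∩ S) → u ∈ R → v ∈ S → ¬ Adj T u v
  tight-apart {R = R} {S = S} R-subtree S-subtree R-tight S-tight apart u∈ v∈ u~v =
    <⇒≱ t≥1 (+-cancelˡ-≤ (chipsOn s (R ∪ S) + t) t 0 squeezed)
    where
    c∪ : ℕ
    c∪ = chipsOn s (R ∪ S)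
    modular : (c∪ + t) + (chipsOn s ⊥ + t) ≡ t * ∣ R ∪ S ∣ + t * ∣ ⊥ {n} ∣
    modular = subst (λ I → (c∪ + t) + (chipsOn s I + t) ≡ t * ∣ R ∪ S ∣ + t * ∣ I ∣)
                    (Empty-unique apart) (tight-∪-∩ u∈ v∈ R-tight S-tight)
    ∪-subtree : IsSubtree T (R ∪ S)
    ∪-subtree = subtree-∪ T R-subtree S-subtree u∈ v∈ (step (x∈p∪q⁺ (inj₁ u∈)) u~v (stop (x∈p∪q⁺ (inj₂ v∈))))
    squeezed : (c∪ + t) + t ≤ (c∪ + t) + 0
    squeezed = begin
      (c∪ + t) + t                  ≡⟨ cong (λ c → (c∪ + t) + (c + t)) (sym (chipsOn-⊥ s)) ⟩
      (c∪ + t) + (chipsOn s ⊥ + t)  ≡⟨ modular ⟩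
      t * ∣ R ∪ S ∣ + t * ∣ ⊥ {n} ∣  ≡⟨ cong (λ m → t * ∣ R ∪ S ∣ + t * m) (∣⊥∣≡0 n) ⟩
      t * ∣ R ∪ S ∣ + t * 0          ≡⟨ cong (t * ∣ R ∪ S ∣ +_) (*-zeroʳ t) ⟩
      t * ∣ R ∪ S ∣ + 0              ≡⟨ +-identityʳ _ ⟩
      t * ∣ R ∪ S ∣                  ≤⟨ dilated⁺ ∪-subtree ⟩
      c∪ + t                        ≡⟨ sym (+-identityʳ _) ⟩
      (c∪ + t) + 0                  ∎
      where open ≤-Reasoning

  tight-⊤ : (∀ u → ¬ Removable u) → IsSubtree T S → Tight S → Tight ⊤
  tight-⊤ none = grow (⊃-wellFounded _)
    where
    grow : Acc _⊃_ S → IsSubtree T S → Tight S → Tight ⊤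
    grow {S = S} (acc larger) S-subtree@((x , x∈S) , _) S-tight with nonempty? (∁ S)
    ... | no full = subst Tight (⊆-antisym ⊆⊤ λ _ → x∉∁p⇒x∈p λ y∈∁S → full (_ , y∈∁S)) S-tight
    ... | yes (v , v∈∁S) with exit-edge T x∈S (x∈∁p⇒x∉p v∈∁S) (proj₁ tree x v ∈⊤ ∈⊤)
    ...   | a , b , a∈S , b∉S , a~b with tight-cover b (none b)
    ...     | R , R-subtree , b∈R , R-tight with nonempty? (R ∩ S)
    ...       | no apart =
                  contradiction (Adj-sym T a~b) (tight-apart R-subtree S-subtree R-tight S-tight apart b∈R a∈S)
    ...       | yes meet = grow (larger S⊂R∪S) (overlapping-subtree-∪ T R-subtree S-subtree meet)
                                (tight-∪ R-subtree S-subtree meet R-tight S-tight)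
      where
      S⊂R∪S : S ⊂ R ∪ S
      S⊂R∪S = q⊆p∪q R S , b , x∈p∪q⁺ (inj₁ b∈R) , b∉S

  minimally-dilated : 0 < n → (∀ u → ¬ Removable u) → MinimallyDilated T t s
  minimally-dilated 0<n none with tight-cover (fromℕ< 0<n) (none _)
  ... | R , R-subtree , _ , R-tight = dil , (begin
    total s              ≡⟨ sym (chipsOn-⊤ s) ⟩
    chipsOn s ⊤          ≡⟨ tight-⊤ none R-subtree R-tight ⟩
    t * (∣ ⊤ {n} ∣ ∸ 1)  ≡⟨ cong (λ m → t * (m ∸ 1)) (∣⊤∣≡n n) ⟩
    t * (n ∸ 1)          ∎)
    where open ≡-Reasoning

lemma4p6 : (n : ℕ) → 1 ≤ n → (T : SimpleGraph n) → IsTree T →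
    (t : ℕ) → 1 ≤ t → (s : Config n) → Dilated T t s → ¬ MinimallyDilated T t s →
    Σ (Fin n) (λ i → (1 ≤ s i) × Dilated T t (minusE s i))
lemma4p6 n n≥1 T tree t t≥1 s dil not-minimal with any? (removable? tree t≥1 dil)
... | yes removable = removable
... | no none = contradiction (minimally-dilated tree t≥1 dil n≥1 λ u r → none (u , r)) not-minimal
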